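{- Let $x, y, q, k, n$ be positive integers with $n$ and $q$ prime, $q \ge 3$, $n \ge 3$, $\gcd(x,y)=1$, $y$ odd, and $$x^2 - q^{2k} = y^n.$$ Then $n \mid q-1$, and there exists an odd positive integer $X$ such that $y = X(X+2)$ and $$(X+2)^n - X^n = 2q^k.$$ -}

module Defs where

open import Data.Nat using (ℕ; _+_; _*_)
open import Data.Product using (Σ)
open import Relation.Binary.PropositionalEquality using (_≡_)

Odd : ℕ → Set
Odd m = Σ ℕ (λ j → m ≡ 2 * j + 1)

{-# OPTIONS --safe #-}

-- Put Q = qᵏ. As y is odd and prime to x, the factors x − Q and x + Q of yⁿ are coprime,
-- so x − Q = aⁿ and x + Q = bⁿ with y = a b, whence bⁿ = aⁿ + 2Q. Writing b = a + 2s and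
-- expanding (a + 2s)ⁿ to second order gives Q = s Φ with Φ = n aⁿ⁻¹ + s (…). Were q ∣ s,
-- the power of q that is Φ would exceed q, hence be divisible by q², which first forces
-- q = n and then q ∣ a; so s = 1. Finally aⁿ ≡ bⁿ but a ≢ b (mod q), so the exponents e
-- with aᵉ ≡ bᵉ (mod q), closed under sums and differences, contain n and, by Fermat,
-- q − 1, but not gcd(n, q − 1); hence n ∣ q − 1.

module Submission where

open import Data.Empty using (⊥; ⊥-elim)
open import Data.List using ([]; _∷_)
open import Data.List.Relation.Unary.All using (All; []; _∷_)
open import Data.Nat
open import Data.Nat.Coprimality as Coprime using (Coprime; coprime-divisor; gcd≡1⇒coprime; coprime⇒gcd≡1)
open import Data.Nat.Divisibility
open import Data.Nat.GCD using (gcd; module Bézout; gcd-GCD; gcd-greatest)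
open import Data.Nat.ListAction using (product)
open import Data.Nat.Primality
open import Data.Nat.Primality.Factorisation using (factorise)
open import Data.Nat.Properties
open import Algebra.Properties.CommutativeSemigroup *-commutativeSemigroup using ()
  renaming ( interchange to *-interchange; xy∙z≈xz∙y to xy∙z≡xz∙y
           ; x∙yz≈yx∙z to x∙yz≡yx∙z; x∙yz≈y∙xz to x∙yz≡y∙xz )
open import Algebra.Properties.CommutativeSemigroup +-commutativeSemigroup using ()
  renaming (xy∙z≈xz∙y to xy+z≡xz+y)
open import Data.Nat.Tactic.RingSolver using (solve-∀)
open import Data.Product using (Σ; ∃; ∃₂; _×_; _,_)
open import Data.Sum using (inj₁; inj₂; [_,_]′; reduce)
open import Function using (_∘_; flip; id)
open import Relation.Binary.PropositionalEquality
  using (_≡_; refl; sym; trans; cong; cong₂; subst; subst₂; module ≡-Reasoning)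
open import Relation.Nullary using (¬_; yes; no)

open import Defs

private
  variable
    a b c d e k m n o p q s u v x y : ℕ

prime∤1 : Prime p → ¬ p ∣ 1
prime∤1 {p} pp p∣1 = <⇒≢ (nonTrivial⇒n>1 p {{prime⇒nonTrivial pp}}) (sym (∣1⇒≡1 p∣1))

prime∣^⇒∣ : ∀ n → Prime p → p ∣ m ^ n → p ∣ m
prime∣^⇒∣ zero pp p∣1 = ⊥-elim (prime∤1 pp p∣1)
prime∣^⇒∣ {m = m} (suc n) pp p∣m^[1+n] with euclidsLemma m (m ^ n) pp p∣m^[1+n]
... | inj₁ p∣m   = p∣m
... | inj₂ p∣m^n = prime∣^⇒∣ n pp p∣m^n

prime∤⇒coprime : Prime p → ¬ p ∣ m → Coprime p m
prime∤⇒coprime pp p∤m (d∣p , d∣m) with prime⇒irreducible pp d∣p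
... | inj₁ d≡1 = d≡1
... | inj₂ refl = ⊥-elim (p∤m d∣m)

coprime-* : Coprime m n → Coprime m o → Coprime m (n * o)
coprime-* {m} {n} m⊥n m⊥o {d} (d∣m , d∣no) = m⊥o (d∣m , coprime-divisor d⊥n d∣no)
  where
  d⊥n : Coprime d n
  d⊥n (e∣d , e∣n) = m⊥n (∣-trans e∣d d∣m , e∣n)

coprime-^ : ∀ k → Coprime m n → Coprime m (n ^ k)
coprime-^ zero    _   (_ , d∣1) = ∣1⇒≡1 d∣1
coprime-^ (suc k) m⊥n = coprime-* m⊥n (coprime-^ k m⊥n)

∣⇒∣^ : ∀ n .{{_ : NonZero n}} → d ∣ m → d ∣ m ^ n
∣⇒∣^ (suc n) d∣m = ∣m⇒∣m*n _ d∣m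

^-distribʳ-* : ∀ m n k → (m * n) ^ k ≡ m ^ k * n ^ k
^-distribʳ-* m n zero    = refl
^-distribʳ-* m n (suc k) = begin
  m * n * (m * n) ^ k     ≡⟨ cong (m * n *_) (^-distribʳ-* m n k) ⟩
  m * n * (m ^ k * n ^ k) ≡⟨ *-interchange m n (m ^ k) (n ^ k) ⟩
  m * m ^ k * (n * n ^ k) ∎
  where open ≡-Reasoning

∣prime^⇒≡prime^ : Prime p → ∀ k → m ∣ p ^ k → ∃ λ i → m ≡ p ^ i
∣prime^⇒≡prime^ pp zero m∣1 = 0 , ∣1⇒≡1 m∣1
∣prime^⇒≡prime^ {p} {m} pp (suc k) m∣p^[1+k] with p ∣? m
... | no p∤m = ∣prime^⇒≡prime^ pp k (coprime-divisor (Coprime.sym (prime∤⇒coprime pp p∤m)) m∣p^[1+k])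
... | yes (divides m′ refl) with ∣prime^⇒≡prime^ {m = m′} pp k m′∣p^k
  where
  instance
    p≢0 : NonZero p
    p≢0 = prime⇒nonZero pp
  m′∣p^k : m′ ∣ p ^ k
  m′∣p^k = *-cancelʳ-∣ p (subst (m′ * p ∣_) (*-comm p (p ^ k)) m∣p^[1+k])
...   | i , refl = suc i , *-comm (p ^ i) p

infix 4 _≡_mod_

_≡_mod_ : ℕ → ℕ → ℕ → Set
_≡_mod_ m n d = ∃₂ λ k l → m + k * d ≡ n + l * d

≡-mod-refl : m ≡ m mod d
≡-mod-refl = 0 , 0 , refl

≡-mod-sym : m ≡ n mod d → n ≡ m mod d
≡-mod-sym (k , l , eq) = l , k , sym eq

≡-mod-trans : m ≡ n mod d → n ≡ o mod d → m ≡ o mod d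
≡-mod-trans {m} {n} {d} {o} (k , l , m≈n) (k′ , l′ , n≈o) = k + k′ , l′ + l , (begin
  m + (k + k′) * d    ≡⟨ shuffle m k k′ d ⟩
  (m + k * d) + k′ * d ≡⟨ cong (_+ k′ * d) m≈n ⟩
  n + l * d + k′ * d  ≡⟨ xy+z≡xz+y n (l * d) (k′ * d) ⟩
  (n + k′ * d) + l * d ≡⟨ cong (_+ l * d) n≈o ⟩
  o + l′ * d + l * d  ≡⟨ shuffle o l′ l d ⟨
  o + (l′ + l) * d    ∎)
  where
  open ≡-Reasoning
  shuffle : ∀ m k k′ d → m + (k + k′) * d ≡ (m + k * d) + k′ * d
  shuffle = solve-∀

≡-mod-+ʳ : ∀ c → m ≡ n mod d → m + c ≡ n + c mod d
≡-mod-+ʳ {m} {n} {d} c (k , l , m≈n) = k , l , (begin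
  m + c + k * d ≡⟨ xy+z≡xz+y m c (k * d) ⟩
  m + k * d + c ≡⟨ cong (_+ c) m≈n ⟩
  n + l * d + c ≡⟨ xy+z≡xz+y n (l * d) c ⟩
  n + c + l * d ∎)
  where open ≡-Reasoning

≡-mod-+ˡ : ∀ c → m ≡ n mod d → c + m ≡ c + n mod d
≡-mod-+ˡ {m} {n} {d} c m≈n = subst₂ (λ s t → s ≡ t mod d) (+-comm m c) (+-comm n c) (≡-mod-+ʳ c m≈n)

≡-mod-*ʳ : ∀ c → m ≡ n mod d → m * c ≡ n * c mod d
≡-mod-*ʳ {m} {n} {d} c (k , l , m≈n) = k * c , l * c , (begin
  m * c + k * c * d   ≡⟨ distrib m k c d ⟩
  (m + k * d) * c     ≡⟨ cong (_* c) m≈n ⟩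
  (n + l * d) * c     ≡⟨ distrib n l c d ⟨
  n * c + l * c * d   ∎)
  where
  open ≡-Reasoning
  distrib : ∀ m k c d → m * c + k * c * d ≡ (m + k * d) * c
  distrib = solve-∀

≡-mod-* : m ≡ n mod d → o ≡ e mod d → m * o ≡ n * e mod d
≡-mod-* {m} {n} {d} {o} {e} m≈n o≈e = ≡-mod-trans (≡-mod-*ʳ o m≈n)
  (subst₂ (λ s t → s ≡ t mod d) (*-comm o n) (*-comm e n) (≡-mod-*ʳ n o≈e))

∣⇒≡-mod : d ∣ e → m + e ≡ m mod d
∣⇒≡-mod {d} {m = m} (divides j refl) = 0 , j , +-identityʳ (m + j * d)

≡-mod⇒∣ : m + e ≡ m mod d → d ∣ e
≡-mod⇒∣ {m} {e} {d} (k , l , eq) = ∣m+n∣m⇒∣n (subst (d ∣_) ld≡kd+e (n∣m*n l)) (n∣m*n k)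
  where
  ld≡kd+e : l * d ≡ k * d + e
  ld≡kd+e = +-cancelˡ-≡ m _ _ (begin
    m + l * d       ≡⟨ eq ⟨
    m + e + k * d   ≡⟨ +-assoc m e (k * d) ⟩
    m + (e + k * d) ≡⟨ cong (m +_) (+-comm e (k * d)) ⟩
    m + (k * d + e) ∎)
    where open ≡-Reasoning

≡-mod-*-cancelˡ : Prime p → ¬ p ∣ c → c * m ≡ c * n mod p → m ≡ n mod p
≡-mod-*-cancelˡ {p} {c} {m} {n} pp p∤c cm≈cn =
  [ (λ m≤n → cancel m≤n cm≈cn) , (λ n≤m → ≡-mod-sym (cancel n≤m (≡-mod-sym cm≈cn))) ]′ (≤-total m n)
  where
  cancel : ∀ {m n} → m ≤ n → c * m ≡ c * n mod p → m ≡ n mod p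
  cancel {m} m≤n cm≈cn with m≤n⇒∃[o]m+o≡n m≤n
  ... | E , refl = ≡-mod-sym (∣⇒≡-mod p∣E)
    where
    p∣cE : p ∣ c * E
    p∣cE = ≡-mod⇒∣ (subst (λ t → t ≡ c * m mod p) (*-distribˡ-+ c m E) (≡-mod-sym cm≈cn))
    p∣E : p ∣ E
    p∣E = [ ⊥-elim ∘ p∤c , id ]′ (euclidsLemma c E pp p∣cE)

-- Pascal's recursion (the library's n C k is n P k / k!) makes the binomial theorem a direct induction.
choose : ℕ → ℕ → ℕ
choose n       zero    = 1
choose zero    (suc k) = 0
choose (suc n) (suc k) = choose n k + choose n (suc k)

n<k⇒choose≡0 : n < k → choose n k ≡ 0
n<k⇒choose≡0 {zero}  {suc k} _ = refl
n<k⇒choose≡0 {suc n} {suc k} (s≤s n<k) = cong₂ _+_ (n<k⇒choose≡0 n<k) (n<k⇒choose≡0 (m<n⇒m<1+n n<k))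

choose-diag : ∀ n → choose n n ≡ 1
choose-diag zero    = refl
choose-diag (suc n) = cong₂ _+_ (choose-diag n) (n<k⇒choose≡0 (n<1+n n))

choose-1 : ∀ n → choose n 1 ≡ n
choose-1 zero    = refl
choose-1 (suc n) = cong suc (choose-1 n)

choose-absorb : ∀ n k → suc k * choose (suc n) (suc k) ≡ suc n * choose n k
choose-absorb zero    zero    = refl
choose-absorb zero    (suc k) = *-zeroʳ (2 + k)
choose-absorb (suc n) zero    = cong suc (trans (+-identityʳ _) (trans (choose-1 (suc n)) (sym (*-identityʳ (suc n)))))
choose-absorb (suc n) (suc k) = begin
  (2 + k) * (C[1+n,1+k] + choose (suc n) (2 + k))                   ≡⟨ *-distribˡ-+ (2 + k) C[1+n,1+k] _ ⟩
  (2 + k) * C[1+n,1+k] + (2 + k) * choose (suc n) (2 + k)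
    ≡⟨ cong₂ _+_ (cong (C[1+n,1+k] +_) (choose-absorb n k)) (choose-absorb n (suc k)) ⟩
  C[1+n,1+k] + (1 + n) * choose n k + (1 + n) * choose n (suc k)    ≡⟨ +-assoc C[1+n,1+k] _ _ ⟩
  C[1+n,1+k] + ((1 + n) * choose n k + (1 + n) * choose n (suc k))  ≡⟨ cong (C[1+n,1+k] +_) (*-distribˡ-+ (1 + n) (choose n k) _) ⟨
  (2 + n) * C[1+n,1+k]                                              ∎
  where
  open ≡-Reasoning
  C[1+n,1+k] : ℕ
  C[1+n,1+k] = choose (suc n) (suc k)

prime∣choose : Prime p → 0 < k → k < p → p ∣ choose p k
prime∣choose {suc p′} {suc k} pp _ k<p
  with euclidsLemma (suc k) _ pp (divides (choose p′ k) (trans (choose-absorb p′ k) (*-comm (suc p′) _)))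
... | inj₁ p∣k    = ⊥-elim (<⇒≱ k<p (∣⇒≤ p∣k))
... | inj₂ p∣Cpk = p∣Cpk

binomialSum : ℕ → ℕ → ℕ → ℕ
binomialSum n x zero    = 0
binomialSum n x (suc i) = binomialSum n x i + choose n i * x ^ i

binomialSum-pascal : ∀ n x i → binomialSum (suc n) x (suc i) ≡ binomialSum n x (suc i) + x * binomialSum n x i
binomialSum-pascal n x zero    = cong (1 +_) (sym (*-zeroʳ x))
binomialSum-pascal n x (suc i) = begin
  binomialSum (suc n) x (suc i) + (choose n i + choose n (suc i)) * x ^ suc i
    ≡⟨ cong (_+ (choose n i + choose n (suc i)) * x ^ suc i) (binomialSum-pascal n x i) ⟩
  binomialSum n x (suc i) + x * binomialSum n x i + (choose n i + choose n (suc i)) * (x * x ^ i)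
    ≡⟨ regroup (binomialSum n x (suc i)) (binomialSum n x i) (choose n i) (choose n (suc i)) x (x ^ i) ⟩
  binomialSum n x (suc i) + choose n (suc i) * (x * x ^ i) + x * (binomialSum n x i + choose n i * x ^ i)
    ∎
  where
  open ≡-Reasoning
  regroup : ∀ S S′ A B x y → S + x * S′ + (A + B) * (x * y) ≡ S + B * (x * y) + x * (S′ + A * y)
  regroup = solve-∀

binomial-theorem : ∀ n x → (1 + x) ^ n ≡ binomialSum n x (suc n)
binomial-theorem zero    x = refl
binomial-theorem (suc n) x = begin
  (1 + x) * (1 + x) ^ n                         ≡⟨ cong ((1 + x) *_) (binomial-theorem n x) ⟩
  (1 + x) * S                                   ≡⟨ regroup S (x ^ suc n) x ⟩
  S + 0 * x ^ suc n + x * S                     ≡⟨ cong (λ t → S + t * x ^ suc n + x * S) (n<k⇒choose≡0 (n<1+n n)) ⟨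
  binomialSum n x (2 + n) + x * S               ≡⟨ binomialSum-pascal n x (suc n) ⟨
  binomialSum (suc n) x (2 + n)                 ∎
  where
  open ≡-Reasoning
  S : ℕ
  S = binomialSum n x (suc n)
  regroup : ∀ S P x → (1 + x) * S ≡ S + 0 * P + x * S
  regroup = solve-∀

prime-binomialSum≡1 : Prime p → ∀ x i → i < p → binomialSum p x (suc i) ≡ 1 mod p
prime-binomialSum≡1 pp x zero    _       = ≡-mod-refl
prime-binomialSum≡1 pp x (suc i) 1+i<p =
  ≡-mod-trans (∣⇒≡-mod (∣m⇒∣m*n _ (prime∣choose pp (s≤s z≤n) 1+i<p)))
              (prime-binomialSum≡1 pp x i (<-trans (n<1+n i) 1+i<p))

freshmans-dream : Prime p → ∀ x → (1 + x) ^ p ≡ 1 + x ^ p mod p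
freshmans-dream {suc p′} pp x = subst₂ (λ s t → s ≡ t mod suc p′) (sym (binomial-theorem (suc p′) x)) last-term
  (≡-mod-+ʳ _ (prime-binomialSum≡1 pp x p′ ≤-refl))
  where
  last-term : 1 + choose (suc p′) (suc p′) * x ^ suc p′ ≡ 1 + x ^ suc p′
  last-term = trans (cong (λ t → 1 + t * x ^ suc p′) (choose-diag (suc p′))) (cong suc (*-identityˡ _))

fermat : Prime p → ∀ x → x ^ p ≡ x mod p
fermat {suc p′} pp zero    = ≡-mod-refl
fermat          pp (suc x) = ≡-mod-trans (freshmans-dream pp x) (≡-mod-+ˡ 1 (fermat pp x))

fermat-little : Prime p → ¬ p ∣ x → x ^ (p ∸ 1) ≡ 1 mod p
fermat-little {suc p′} {x} pp p∤x =
  ≡-mod-*-cancelˡ pp p∤x (subst (λ t → x ^ suc p′ ≡ t mod suc p′) (sym (*-identityʳ x)) (fermat pp x))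

record DifferenceClosed (P : ℕ → Set) : Set where
  field
    zero-closed : P 0
    +-closed    : ∀ {m n} → P m → P n → P (m + n)
    ∸-closed    : ∀ {m n} → P m → P (m + n) → P n

  *-closed : ∀ k → P m → P (k * m)
  *-closed zero    _  = zero-closed
  *-closed (suc k) Pm = +-closed Pm (*-closed k Pm)

  bézout-closed : Bézout.Identity d m n → P m → P n → P d
  bézout-closed {d} {m} {n} (Bézout.+- x y eq) Pm Pn =
    ∸-closed (*-closed y Pn) (subst P (trans (sym eq) (+-comm d (y * n))) (*-closed x Pm))
  bézout-closed {d} {m} {n} (Bézout.-+ x y eq) Pm Pn =
    ∸-closed (*-closed x Pm) (subst P (trans (sym eq) (+-comm d (x * m))) (*-closed y Pn))

  gcd-closed : P m → P n → P (gcd m n)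
  gcd-closed {m} {n} = bézout-closed (Bézout.identity (gcd-GCD m n))

equal-powers-differenceClosed : Prime p → ¬ p ∣ a → DifferenceClosed (λ e → a ^ e ≡ b ^ e mod p)
equal-powers-differenceClosed {p} {a} {b} pp p∤a = record
  { zero-closed = ≡-mod-refl
  ; +-closed    = λ {m} {n} Pm Pn → subst₂ (λ s t → s ≡ t mod p)
      (sym (^-distribˡ-+-* a m n)) (sym (^-distribˡ-+-* b m n)) (≡-mod-* Pm Pn)
  ; ∸-closed    = λ {m} {n} Pm Pm+n → ≡-mod-*-cancelˡ pp (p∤a ∘ prime∣^⇒∣ m pp)
      (≡-mod-trans (subst₂ (λ s t → s ≡ t mod p) (^-distribˡ-+-* a m n) (^-distribˡ-+-* b m n) Pm+n)
                   (≡-mod-*ʳ (b ^ n) (≡-mod-sym Pm)))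
  }

power-congruence⇒∣∸1 : Prime q → Prime n → ¬ q ∣ a → ¬ q ∣ b →
  a ^ n ≡ b ^ n mod q → ¬ a ≡ b mod q → n ∣ q ∸ 1
power-congruence⇒∣∸1 {q} {n} {a} {b} pq pn q∤a q∤b aⁿ≡bⁿ a≢b with n ∣? q ∸ 1
... | yes n∣q∸1 = n∣q∸1
... | no  n∤q∸1 = ⊥-elim (a≢b (subst₂ (λ s t → s ≡ t mod q) (*-identityʳ a) (*-identityʳ b) a¹≡b¹))
  where
  open DifferenceClosed (equal-powers-differenceClosed {b = b} pq q∤a)
  aᵠ≡bᵠ : a ^ (q ∸ 1) ≡ b ^ (q ∸ 1) mod q
  aᵠ≡bᵠ = ≡-mod-trans (fermat-little pq q∤a) (≡-mod-sym (fermat-little pq q∤b))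
  a¹≡b¹ : a ^ 1 ≡ b ^ 1 mod q
  a¹≡b¹ = subst (λ e → a ^ e ≡ b ^ e mod q) (coprime⇒gcd≡1 (prime∤⇒coprime pn n∤q∸1))
    (gcd-closed {n} {q ∸ 1} aⁿ≡bⁿ aᵠ≡bᵠ)

PowerFactors : ℕ → ℕ → ℕ → ℕ → Set
PowerFactors n y u v = ∃₂ λ a b → u ≡ a ^ n × v ≡ b ^ n × y ≡ a * b

powerFactors-swap : PowerFactors n y u v → PowerFactors n y v u
powerFactors-swap (a , b , u≡aⁿ , v≡bⁿ , y≡ab) = b , a , v≡bⁿ , u≡aⁿ , trans y≡ab (*-comm a b)

powerFactors-prime : ∀ n .{{_ : NonZero n}} → Prime p → p ∣ u → Coprime u v → u * v ≡ (p * m) ^ n →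
  (∀ {u′} → Coprime u′ v → u′ * v ≡ m ^ n → PowerFactors n m u′ v) → PowerFactors n (p * m) u v
powerFactors-prime {p} {u} {v} {m} n pp p∣u u⊥v uv≡[pm]ⁿ factor-m with pⁿ∣u
  where
  instance
    p≢0 : NonZero p
    p≢0 = prime⇒nonZero pp
  p∤v : ¬ p ∣ v
  p∤v p∣v = prime∤1 pp (subst (p ∣_) (u⊥v (p∣u , p∣v)) ∣-refl)
  pⁿ∣u : p ^ n ∣ u
  pⁿ∣u = coprime-divisor (Coprime.sym (coprime-^ n (Coprime.sym (prime∤⇒coprime pp p∤v))))
    (subst (p ^ n ∣_) (trans (sym uv≡[pm]ⁿ) (*-comm u v)) (subst (p ^ n ∣_) (sym (^-distribʳ-* p m n)) (m∣m*n (m ^ n))))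
... | divides u′ refl with factor-m u′⊥v u′v≡mⁿ
  where
  instance
    pⁿ≢0 : NonZero (p ^ n)
    pⁿ≢0 = m^n≢0 p n {{prime⇒nonZero pp}}
  u′⊥v : Coprime u′ v
  u′⊥v (d∣u′ , d∣v) = u⊥v (∣-trans d∣u′ (m∣m*n (p ^ n)) , d∣v)
  u′v≡mⁿ : u′ * v ≡ m ^ n
  u′v≡mⁿ = *-cancelʳ-≡ _ _ (p ^ n) (begin
    u′ * v * p ^ n   ≡⟨ xy∙z≡xz∙y u′ v (p ^ n) ⟩
    u′ * p ^ n * v   ≡⟨ uv≡[pm]ⁿ ⟩
    (p * m) ^ n      ≡⟨ ^-distribʳ-* p m n ⟩
    p ^ n * m ^ n    ≡⟨ *-comm (p ^ n) (m ^ n) ⟩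
    m ^ n * p ^ n    ∎)
    where open ≡-Reasoning
... | a , b , refl , v≡bⁿ , refl = a * p , b , sym (^-distribʳ-* a p n) , v≡bⁿ , x∙yz≡yx∙z p a b

coprime-*≡product^⇒powerFactors : ∀ n .{{_ : NonZero n}} ps → All Prime ps →
  Coprime u v → u * v ≡ product ps ^ n → PowerFactors n (product ps) u v
coprime-*≡product^⇒powerFactors {u} {v} n [] [] _ uv≡1ⁿ = 1 , 1 , u≡1 , v≡1 , refl
  where
  uv≡1 : u * v ≡ 1
  uv≡1 = trans uv≡1ⁿ (^-zeroˡ n)
  u≡1 : u ≡ 1 ^ n
  u≡1 = trans (m*n≡1⇒m≡1 u v uv≡1) (sym (^-zeroˡ n))
  v≡1 : v ≡ 1 ^ n
  v≡1 = trans (m*n≡1⇒n≡1 u v uv≡1) (sym (^-zeroˡ n))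
coprime-*≡product^⇒powerFactors {u} {v} n (p ∷ ps) (pp ∷ pps) u⊥v uv≡yⁿ
  with euclidsLemma u v pp (subst (p ∣_) (sym uv≡yⁿ) (∣⇒∣^ n (m∣m*n (product ps))))
... | inj₁ p∣u = powerFactors-prime n pp p∣u u⊥v uv≡yⁿ (coprime-*≡product^⇒powerFactors n ps pps)
... | inj₂ p∣v = powerFactors-swap {n = n} (powerFactors-prime n pp p∣v (Coprime.sym u⊥v) (trans (*-comm v u) uv≡yⁿ)
                   (coprime-*≡product^⇒powerFactors n ps pps))

coprime-*≡^⇒powerFactors : ∀ n .{{_ : NonZero n}} y .{{_ : NonZero y}} →
  Coprime u v → u * v ≡ y ^ n → PowerFactors n y u v
coprime-*≡^⇒powerFactors n y u⊥v uv≡yⁿ with factorise y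
... | record { factors = ps ; isFactorisation = refl ; factorsPrime = pps } =
  coprime-*≡product^⇒powerFactors n ps pps u⊥v uv≡yⁿ

odd⇒2∤ : Odd m → ¬ 2 ∣ m
odd⇒2∤ (j , refl) 2∣2j+1 = prime∤1 prime[2] (∣m+n∣m⇒∣n 2∣2j+1 (m∣m*n j))

odd⇒>0 : Odd m → m > 0
odd⇒>0 (j , refl) = m≤n+m 1 (2 * j)

2∤⇒odd : ¬ 2 ∣ m → Odd m
2∤⇒odd {zero}        2∤0 = ⊥-elim (2∤0 (divides 0 refl))
2∤⇒odd {suc zero}    _   = 0 , refl
2∤⇒odd {suc (suc m)} 2∤m+2 with 2∤⇒odd {m} (2∤m+2 ∘ ∣m∣n⇒∣m+n ∣-refl)
... | j , refl = suc j , cong (_+ 1) (sym (*-suc 2 j))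

odd-gap : ¬ 2 ∣ a → ¬ 2 ∣ b → a ≤ b → ∃ λ s → b ≡ a + 2 * s
odd-gap 2∤a 2∤b a≤b with 2∤⇒odd 2∤a | 2∤⇒odd 2∤b
... | i , refl | j , refl with m≤n⇒∃[o]m+o≡n (*-cancelˡ-≤ {i} {j} 2 (+-cancelʳ-≤ 1 (2 * i) (2 * j) a≤b))
... | s , refl = s , regroup i s
  where
  regroup : ∀ i s → 2 * (i + s) + 1 ≡ 2 * i + 1 + 2 * s
  regroup = solve-∀

^-cancelˡ-≤ : ∀ n .{{_ : NonZero n}} → a ^ n ≤ b ^ n → a ≤ b
^-cancelˡ-≤ n aⁿ≤bⁿ = ≮⇒≥ (λ b<a → <⇒≱ (^-monoˡ-< n b<a) aⁿ≤bⁿ)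

-- Doubled so that the coefficient n (n − 1) / 2 of t² needs no division.
twice-binomial-second-order : ∀ a t m → ∃ λ c →
  2 * (a + t) ^ (2 + m) ≡ 2 * a ^ (2 + m) + 2 * (2 + m) * a ^ (1 + m) * t + (2 + m) * (1 + m) * a ^ m * (t * t) + t * t * t * c
twice-binomial-second-order a t zero = 0 , expand a t
  where
  expand : ∀ a t → 2 * ((a + t) * ((a + t) * 1)) ≡ 2 * (a * (a * 1)) + 2 * 2 * (a * 1) * t + 2 * 1 * 1 * (t * t) + t * t * t * 0
  expand = solve-∀
twice-binomial-second-order a t (suc m) with twice-binomial-second-order a t m
... | c , eq = (2 + m) * (1 + m) * a ^ m + c * (a + t) , (begin
  2 * ((a + t) * (a + t) ^ (2 + m))     ≡⟨ x∙yz≡y∙xz 2 (a + t) _ ⟩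
  (a + t) * (2 * (a + t) ^ (2 + m))     ≡⟨ cong ((a + t) *_) eq ⟩
  (a + t) * (2 * a ^ (2 + m) + 2 * (2 + m) * a ^ (1 + m) * t + (2 + m) * (1 + m) * a ^ m * (t * t) + t * t * t * c)
    ≡⟨ expand a t (a ^ m) m c ⟩
  2 * a ^ (3 + m) + 2 * (3 + m) * a ^ (2 + m) * t + (3 + m) * (2 + m) * a ^ (1 + m) * (t * t)
    + t * t * t * ((2 + m) * (1 + m) * a ^ m + c * (a + t)) ∎)
  where
  open ≡-Reasoning
  expand : ∀ a t A m c →
    (a + t) * (2 * (a * (a * A)) + 2 * (2 + m) * (a * A) * t + (2 + m) * (1 + m) * A * (t * t) + t * t * t * c) ≡
    2 * (a * (a * (a * A))) + 2 * (3 + m) * (a * (a * A)) * t + (3 + m) * (2 + m) * (a * A) * (t * t)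
      + t * t * t * ((2 + m) * (1 + m) * A + c * (a + t))
  expand = solve-∀

gap-factorisation : ∀ {Q s} m → b ≡ a + 2 * s → b ^ (2 + m) ≡ a ^ (2 + m) + 2 * Q →
  ∃ λ c → Q ≡ s * ((2 + m) * a ^ (1 + m) + s * ((2 + m) * (1 + m) * a ^ m + 2 * s * c))
gap-factorisation {b} {a} {Q} {s} m refl bⁿ≡aⁿ+2Q with twice-binomial-second-order a (2 * s) m
... | c , expansion = c , *-cancelˡ-≡ Q _ 4 (+-cancelˡ-≡ (2 * a ^ (2 + m)) _ _ (begin
  2 * a ^ (2 + m) + 4 * Q          ≡⟨ double (a ^ (2 + m)) Q ⟩
  2 * (a ^ (2 + m) + 2 * Q)        ≡⟨ cong (2 *_) bⁿ≡aⁿ+2Q ⟨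
  2 * (a + 2 * s) ^ (2 + m)        ≡⟨ expansion ⟩
  2 * a ^ (2 + m) + 2 * (2 + m) * a ^ (1 + m) * (2 * s) + (2 + m) * (1 + m) * a ^ m * (2 * s * (2 * s)) + 2 * s * (2 * s) * (2 * s) * c
                                   ≡⟨ regroup (a ^ (2 + m)) (a ^ (1 + m)) (a ^ m) s c m ⟩
  2 * a ^ (2 + m) + 4 * (s * ((2 + m) * a ^ (1 + m) + s * ((2 + m) * (1 + m) * a ^ m + 2 * s * c))) ∎))
  where
  open ≡-Reasoning
  double : ∀ A Q → 2 * A + 4 * Q ≡ 2 * (A + 2 * Q)
  double = solve-∀
  regroup : ∀ A A′ A″ s c m →
    2 * A + 2 * (2 + m) * A′ * (2 * s) + (2 + m) * (1 + m) * A″ * (2 * s * (2 * s)) + 2 * s * (2 * s) * (2 * s) * c ≡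
    2 * A + 4 * (s * ((2 + m) * A′ + s * ((2 + m) * (1 + m) * A″ + 2 * s * c)))
  regroup = solve-∀

∣p^∧p<⇒p*p∣ : Prime p → d ∣ p ^ k → p < d → p * p ∣ d
∣p^∧p<⇒p*p∣ {p} {d} {k} pp d∣pᵏ p<d with ∣prime^⇒≡prime^ pp k d∣pᵏ
... | zero        , refl = ⊥-elim (<⇒≱ p<d (<⇒≤ (nonTrivial⇒n>1 p {{prime⇒nonTrivial pp}})))
... | suc zero    , refl = ⊥-elim (<-irrefl (sym (*-identityʳ p)) p<d)
... | suc (suc i) , refl = subst (p * p ∣_) (*-assoc p p (p ^ i)) (m∣m*n (p ^ i))

p*p∣p*a+s*x⇒p∣a : ∀ p .{{_ : NonZero p}} → p ∣ s → p ∣ x → p * p ∣ p * a + s * x → p ∣ a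
p*p∣p*a+s*x⇒p∣a {s} {x} {a} p p∣s p∣x p²∣pa+sx =
  *-cancelˡ-∣ p (∣m+n∣m⇒∣n (subst (p * p ∣_) (+-comm (p * a) (s * x)) p²∣pa+sx) (*-pres-∣ p∣s p∣x))

-- Φ = qᵏ / s is a power of q exceeding q, so q² ∣ Φ; q ∣ Φ forces q = n, and then Φ ≡ n aⁿ⁻¹ (mod q²).
prime∤gap : Prime q → Prime (2 + m) → ¬ q ∣ a → q ∣ s →
  q ^ k ≡ s * ((2 + m) * a ^ (1 + m) + s * ((2 + m) * (1 + m) * a ^ m + 2 * s * c)) → ⊥
prime∤gap {q} {m} {a} {s} {k} {c} pq pn q∤a q∣s qᵏ≡sΦ = q∤a (prime∣^⇒∣ (1 + m) pq q∣a¹⁺ᵐ)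
  where
  instance
    q≢0 : NonZero q
    q≢0 = prime⇒nonZero pq
  X Φ : ℕ
  X = (2 + m) * (1 + m) * a ^ m + 2 * s * c
  Φ = (2 + m) * a ^ (1 + m) + s * X
  a≢0 : NonZero a
  a≢0 = ≢-nonZero λ { refl → q∤a (divides 0 refl) }
  s≢0 : NonZero s
  s≢0 = ≢-nonZero λ { refl → ≢-nonZero⁻¹ (q ^ k) {{m^n≢0 q k}} qᵏ≡sΦ }
  X≢0 : NonZero X
  X≢0 = >-nonZero (≤-trans (>-nonZero⁻¹ _ {{m*n≢0 ((2 + m) * (1 + m)) (a ^ m) {{_}} {{m^n≢0 a m {{a≢0}}}}}}) (m≤m+n _ _))
  q<Φ : q < Φ
  q<Φ = begin-strict
    q     ≤⟨ ∣⇒≤ {{s≢0}} q∣s ⟩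
    s     ≤⟨ m≤m*n s X {{X≢0}} ⟩
    s * X <⟨ m<n+m (s * X) (>-nonZero⁻¹ _ {{m*n≢0 (2 + m) (a ^ (1 + m)) {{_}} {{m^n≢0 a (1 + m) {{a≢0}}}}}}) ⟩
    Φ     ∎
    where open ≤-Reasoning
  q²∣Φ : q * q ∣ Φ
  q²∣Φ = ∣p^∧p<⇒p*p∣ {k = k} pq (divides s qᵏ≡sΦ) q<Φ
  q∣[2+m]a¹⁺ᵐ : q ∣ (2 + m) * a ^ (1 + m)
  q∣[2+m]a¹⁺ᵐ = ∣m+n∣m⇒∣n (subst (q ∣_) (+-comm _ (s * X)) (m*n∣⇒m∣ q q q²∣Φ)) (∣m⇒∣m*n X q∣s)
  q∣2+m : q ∣ 2 + m
  q∣2+m with euclidsLemma (2 + m) (a ^ (1 + m)) pq q∣[2+m]a¹⁺ᵐ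
  ... | inj₁ q∣2+m  = q∣2+m
  ... | inj₂ q∣a¹⁺ᵐ = ⊥-elim (q∤a (prime∣^⇒∣ (1 + m) pq q∣a¹⁺ᵐ))
  q≡2+m : q ≡ 2 + m
  q≡2+m = [ (λ q≡1 → ⊥-elim (¬prime[1] (subst Prime q≡1 pq))) , id ]′ (prime⇒irreducible pn q∣2+m)
  q∣X : q ∣ X
  q∣X = ∣m∣n⇒∣m+n (∣m⇒∣m*n (a ^ m) (∣m⇒∣m*n (1 + m) q∣2+m)) (∣m⇒∣m*n c (∣n⇒∣m*n 2 q∣s))
  q∣a¹⁺ᵐ : q ∣ a ^ (1 + m)
  q∣a¹⁺ᵐ = p*p∣p*a+s*x⇒p∣a q q∣s q∣X (subst (λ t → q * q ∣ t * a ^ (1 + m) + s * X) (sym q≡2+m) q²∣Φ)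

power-difference⇒gap≡2 : Prime q → Prime (2 + m) → ¬ q ∣ a → ¬ 2 ∣ a → ¬ 2 ∣ b →
  b ^ (2 + m) ≡ a ^ (2 + m) + 2 * q ^ k → b ≡ a + 2
power-difference⇒gap≡2 {q} {m} {a} {b} {k} pq pn q∤a 2∤a 2∤b bⁿ≡aⁿ+2qᵏ
  with odd-gap 2∤a 2∤b a≤b
  where
  a≤b : a ≤ b
  a≤b = ^-cancelˡ-≤ (2 + m) (subst (a ^ (2 + m) ≤_) (sym bⁿ≡aⁿ+2qᵏ) (m≤m+n (a ^ (2 + m)) (2 * q ^ k)))
... | s , b≡a+2s with gap-factorisation {a = a} {s = s} m b≡a+2s bⁿ≡aⁿ+2qᵏ
... | c , qᵏ≡sΦ with ∣prime^⇒≡prime^ {m = s} pq k (subst (s ∣_) (sym qᵏ≡sΦ) (m∣m*n _))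
... | zero  , refl = b≡a+2s
... | suc j , refl = ⊥-elim (prime∤gap {k = k} {c = c} pq pn q∤a (m∣m*n (q ^ j)) qᵏ≡sΦ)

difference-of-squares : ∀ {Q w} → x * x ≡ Q * Q + w → ∃ λ u → x ≡ Q + u × u * (u + 2 * Q) ≡ w
difference-of-squares {x} {Q} {w} x²≡Q²+w with m≤n⇒∃[o]m+o≡n Q≤x
  where
  Q≤x : Q ≤ x
  Q≤x = ≮⇒≥ λ x<Q → <⇒≱ (*-mono-< x<Q x<Q) (subst (Q * Q ≤_) (sym x²≡Q²+w) (m≤m+n (Q * Q) w))
... | u , refl = u , refl , +-cancelˡ-≡ (Q * Q) _ _ (trans (expand Q u) x²≡Q²+w)
  where
  expand : ∀ Q u → Q * Q + u * (u + 2 * Q) ≡ (Q + u) * (Q + u)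
  expand = solve-∀

coprime-conjugates : ∀ {Q} → Coprime (Q + u) (u * (u + 2 * Q)) → ¬ 2 ∣ u → Coprime u (u + 2 * Q)
coprime-conjugates {u} {Q} x⊥uv 2∤u {d} (d∣u , d∣v) = x⊥uv (∣m∣n⇒∣m+n d∣Q d∣u , ∣m⇒∣m*n (u + 2 * Q) d∣u)
  where
  d⊥2 : Coprime d 2
  d⊥2 = Coprime.sym (prime∤⇒coprime prime[2] (λ 2∣d → 2∤u (∣-trans 2∣d d∣u)))
  d∣Q : d ∣ Q
  d∣Q = coprime-divisor d⊥2 (∣m+n∣m⇒∣n d∣v d∣u)

coprime-square-difference : ∀ {Q} n .{{_ : NonZero n}} → Coprime x y → ¬ 2 ∣ y → x * x ≡ Q * Q + y ^ n →
  ∃₂ λ a b → y ≡ a * b × b ^ n ≡ a ^ n + 2 * Q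
coprime-square-difference {x} {y} {Q} n x⊥y 2∤y x²≡Q²+yⁿ with difference-of-squares {x} {Q} x²≡Q²+yⁿ
... | u , refl , uv≡yⁿ with coprime-*≡^⇒powerFactors n y {{y≢0}} u⊥v uv≡yⁿ
  where
  y≢0 : NonZero y
  y≢0 = ≢-nonZero λ { refl → 2∤y (divides 0 refl) }
  2∤u : ¬ 2 ∣ u
  2∤u 2∣u = 2∤y (prime∣^⇒∣ n prime[2] (subst (2 ∣_) uv≡yⁿ (∣m⇒∣m*n _ 2∣u)))
  u⊥v : Coprime u (u + 2 * Q)
  u⊥v = coprime-conjugates (subst (Coprime (Q + u)) (sym uv≡yⁿ) (coprime-^ n x⊥y)) 2∤u
... | a , b , refl , v≡bⁿ , y≡ab = a , b , y≡ab , sym v≡bⁿ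

twin-factors : Prime q → 3 ≤ q → 1 ≤ k → Prime (2 + m) → ¬ q ∣ a * b → ¬ 2 ∣ a * b →
  b ^ (2 + m) ≡ a ^ (2 + m) + 2 * q ^ k → b ≡ a + 2 × 2 + m ∣ q ∸ 1
twin-factors {q} {k} {m} {a} {b} pq 3≤q 1≤k pn q∤ab 2∤ab bⁿ≡aⁿ+2qᵏ =
  b≡a+2 , power-congruence⇒∣∸1 pq pn q∤a q∤b aⁿ≡bⁿ a≢b
  where
  q∤a : ¬ q ∣ a
  q∤a = q∤ab ∘ ∣m⇒∣m*n b
  q∤b : ¬ q ∣ b
  q∤b = q∤ab ∘ ∣n⇒∣m*n a
  b≡a+2 : b ≡ a + 2
  b≡a+2 = power-difference⇒gap≡2 {k = k} pq pn q∤a (2∤ab ∘ ∣m⇒∣m*n b) (2∤ab ∘ ∣n⇒∣m*n a) bⁿ≡aⁿ+2qᵏ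
  aⁿ≡bⁿ : a ^ (2 + m) ≡ b ^ (2 + m) mod q
  aⁿ≡bⁿ = ≡-mod-sym (subst (λ t → t ≡ a ^ (2 + m) mod q) (sym bⁿ≡aⁿ+2qᵏ)
    (∣⇒≡-mod (∣n⇒∣m*n 2 (∣⇒∣^ k {{>-nonZero 1≤k}} ∣-refl))))
  a≢b : ¬ a ≡ b mod q
  a≢b a≡b = <⇒≱ 3≤q (∣⇒≤ (≡-mod⇒∣ (≡-mod-sym (subst (λ t → a ≡ t mod q) b≡a+2 a≡b))))

proposition3p1 : (x y q k n : ℕ) → 1 ≤ x → 1 ≤ y → 1 ≤ k → Prime n → Prime q → 3 ≤ q → 3 ≤ n → gcd x y ≡ 1 → Odd y → x ^ 2 ≡ q ^ (2 * k) + y ^ n →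
    (n ∣ q ∸ 1) × Σ ℕ (λ X → Odd X × 1 ≤ X × y ≡ X * (X + 2) × (X + 2) ^ n ≡ X ^ n + 2 * q ^ k)
proposition3p1 x y q k n _ _ 1≤k pn pq 3≤q (s≤s (s≤s (s≤s _))) gcd≡1 odd-y x²≡q²ᵏ+yⁿ =
  let a , b , y≡ab , bⁿ≡aⁿ+2qᵏ = coprime-square-difference {x = x} {Q = q ^ k} n (gcd≡1⇒coprime gcd≡1) 2∤y x²≡Q²+yⁿ
      b≡a+2 , n∣q∸1 = twin-factors {k = k} pq 3≤q 1≤k pn
                        (q∤y ∘ subst (q ∣_) (sym y≡ab)) (2∤y ∘ subst (2 ∣_) (sym y≡ab)) bⁿ≡aⁿ+2qᵏ
      odd-a = 2∤⇒odd (2∤y ∘ flip ∣-trans (divides b (trans y≡ab (*-comm a b))))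
  in  n∣q∸1 , a , odd-a , odd⇒>0 odd-a , trans y≡ab (cong (a *_) b≡a+2)
    , subst (λ t → t ^ n ≡ a ^ n + 2 * q ^ k) b≡a+2 bⁿ≡aⁿ+2qᵏ
  where
  2∤y : ¬ 2 ∣ y
  2∤y = odd⇒2∤ odd-y
  x²≡Q²+yⁿ : x * x ≡ q ^ k * q ^ k + y ^ n
  x²≡Q²+yⁿ = begin
    x * x                   ≡⟨ cong (x *_) (*-identityʳ x) ⟨
    x ^ 2                   ≡⟨ x²≡q²ᵏ+yⁿ ⟩
    q ^ (2 * k) + y ^ n     ≡⟨ cong (λ e → q ^ e + y ^ n) (*-comm 2 k) ⟩
    q ^ (k * 2) + y ^ n     ≡⟨ cong (_+ y ^ n) (^-*-assoc q k 2) ⟨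
    (q ^ k) ^ 2 + y ^ n     ≡⟨ cong (λ t → q ^ k * t + y ^ n) (*-identityʳ (q ^ k)) ⟩
    q ^ k * q ^ k + y ^ n   ∎
    where open ≡-Reasoning
  q∤y : ¬ q ∣ y
  q∤y q∣y = prime∤1 pq (subst (q ∣_) gcd≡1 (gcd-greatest q∣x q∣y))
    where
    q∣x : q ∣ x
    q∣x = reduce (euclidsLemma x x pq (subst (q ∣_) (sym x²≡Q²+yⁿ)
      (∣m∣n⇒∣m+n (∣m⇒∣m*n (q ^ k) (∣⇒∣^ k {{>-nonZero 1≤k}} ∣-refl)) (∣⇒∣^ n q∣y))))
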